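{- Let $n\ge 4$ and let $G$ be a connected $n$-vertex graph with a $(3,2)$-cover that has the minimum possible number of edges among all connected $n$-vertex graphs with a $(3,2)$-cover. Then $G$ has a $(4,1)$-cover and $|E(G)|=F(n)$, where $F(n)$ denotes the minimum number of edges in a connected $n$-vertex graph with a $(4,1)$-cover.
   Context: A graph $G$ has a $(k,\ell)$-cover if every edge of $G$ lies in at least $\ell$ copies of $K_k$ (subgraphs isomorphic to the complete graph on $k$ vertices). Thus a $(3,2)$-cover means every edge lies in at least two triangles, and a $(4,1)$-cover means every edge lies in a copy of $K_4$. -}

module Defs where

open import Data.Nat using (ℕ; _≤_; _<_)
open import Data.Fin using (Fin; toℕ)
open import Data.Bool using (Bool; true; false)
open import Data.List using (List; []; _∷_; length; filter; concatMap)
open import Data.List using (allFin)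
open import Data.Product using (Σ; _×_; _,_; ∃-syntax)
open import Relation.Binary.PropositionalEquality using (_≡_; _≢_)
open import Relation.Nullary using (¬_)
open import Relation.Nullary.Decidable using (yes; no; _×-dec_)
open import Data.Bool.Properties using () renaming (_≟_ to _≟B_)
open import Data.Nat.Properties using () renaming (_<?_ to _<ℕ?_)

record Graph (n : ℕ) : Set where
  field
    adj   : Fin n → Fin n → Bool
    sym   : ∀ u v → adj u v ≡ adj v u
    irrefl : ∀ v → adj v v ≡ false

open Graph public

Adj : ∀ {n} → Graph n → Fin n → Fin n → Set
Adj G u v = adj G u v ≡ true

edges : ∀ {n} → Graph n → List (Fin n × Fin n)
edges {n} G =
  filter (λ p → let (u , v) = p in (toℕ u <ℕ? toℕ v) ×-dec (adj G u v ≟B true))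
    (concatMap (λ u → Data.List.map (λ v → (u , v)) (allFin n)) (allFin n))

numEdges : ∀ {n} → Graph n → ℕ
numEdges G = length (edges G)

data Walk {n} (G : Graph n) : Fin n → Fin n → Set where
  here : ∀ {u} → Walk G u u
  step : ∀ {u w v} → Adj G u w → Walk G w v → Walk G u v

Connected : ∀ {n} → Graph n → Set
Connected G = ∀ u v → Walk G u v

-- (3,2)-cover: every edge lies in at least two triangles,
-- i.e. there are two distinct common neighbours of its endpoints
Cover32 : ∀ {n} → Graph n → Set
Cover32 G = ∀ u v → Adj G u v →
  ∃[ w ] ∃[ w' ] (w ≢ w' × Adj G u w × Adj G v w × Adj G u w' × Adj G v w')

-- (4,1)-cover: every edge lies in a copy of K4
Cover41 : ∀ {n} → Graph n → Set
Cover41 G = ∀ u v → Adj G u v →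
  ∃[ w ] ∃[ x ] (Adj G w x × Adj G u w × Adj G v w × Adj G u x × Adj G v x)

IsF : ℕ → ℕ → Set
IsF n m =
  (∃[ H ] (Connected {n} H × Cover41 H × numEdges H ≡ m)) ×
  (∀ (H : Graph n) → Connected H → Cover41 H → m ≤ numEdges H)

-- For S ⊆ V let Φ(S) = 2e(S) + 4|V ∖ S|.  Adding to S a vertex with d neighbours in S changes Φ
-- by 2d − 4.  In a connected graph with a (3,2)-cover such vertices with d ≥ 2 can always be found
-- (a crossing edge and a common neighbour of its ends provide one), so Φ(S) ≤ Φ(V) = 2|E| for every
-- nonempty S, and Φ(S) + 2 ≤ 2|E| if some vertex outside S has two neighbours in S.
-- If an edge uv lies in no K₄, take S = N(u) ∪ N(v).  Every vertex of S other than u, v has at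
-- least three neighbours in S, four if it is a common neighbour of u and v, and u, v keep all their
-- neighbours; since u and v have two common neighbours, discharging gives Φ(S) ≥ 4n − 2.  A case
-- analysis around a common neighbour of u and v finds either one more neighbour inside S or an
-- outside vertex with two neighbours in S, so 2|E| ≥ 4n − 1.
-- On the other hand K₄, K₅ − e, K₆ − C₄ and the graphs obtained from them by attaching K₄'s at a
-- vertex are connected, have a (3,2)-cover and satisfy 2|E| ≤ 4n − 2.  Hence in a minimum G every
-- edge lies in a K₄, and as a (4,1)-cover is a (3,2)-cover, G is also minimum for (4,1)-covers.

module Submission where

open import Defs hiding (sym)
open import Data.Bool using (Bool; true; false; _∧_; _∨_; not)
open import Data.Bool.Properties using (∧-identityʳ; ∧-zeroʳ; ∨-zeroʳ) renaming (_≟_ to _≟ᵇ_)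
open import Data.Empty using (⊥-elim)
open import Data.Fin using (Fin; zero; suc; toℕ)
open import Data.Fin.Patterns using (0F; 1F; 2F; 3F; 4F; 5F)
open import Data.Fin.Properties using (_≟_; all?; any?; toℕ-injective)
open import Data.List using (List; []; _∷_; _++_; length; filter; tabulate; concatMap; map)
open import Data.List.Properties using (filter-++; length-++; map-tabulate)
open import Data.List.Relation.Unary.All as All using (All; []; _∷_)
open import Data.List.Relation.Unary.AllPairs using (AllPairs; []; _∷_)
open import Data.Nat using (ℕ; zero; suc; _+_; _*_; _≤_; _<_; _≤?_; z≤n; s≤s)
open import Data.Nat.Properties hiding (_≟_)
open import Algebra.Properties.CommutativeMonoid.Sum +-0-commutativeMonoid using (sum; ∑-distrib-+; ∑-comm; sum-cong-≗)
open import Algebra.Properties.Semiring.Sum +-*-semiring using (*-distribˡ-sum)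
open import Data.Nat.Tactic.RingSolver using (solve-∀)
open import Data.Product as Product using (_×_; _,_; proj₁; proj₂; ∃-syntax)
open import Data.Sum using (_⊎_; inj₁; inj₂)
open import Function using (_∘_)
open import Relation.Binary.Definitions using (tri<; tri≈; tri>)
open import Relation.Binary.PropositionalEquality
open import Relation.Nullary using (Dec; ¬_; ¬?; yes; no; does)
open import Relation.Nullary.Decidable using (True; toWitness; _×-dec_; _→-dec_; _⊎-dec_; dec-true; dec-false; decidable-stable)
open import Relation.Unary using (Pred; Decidable)

-- Counting over Fin n

true≢false : true ≢ false
true≢false ()

⟦_⟧ : Bool → ℕ
⟦ true  ⟧ = 1
⟦ false ⟧ = 0

⟦∧⟧ : ∀ a b → ⟦ a ∧ b ⟧ ≡ ⟦ a ⟧ * ⟦ b ⟧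
⟦∧⟧ true  b = sym (+-identityʳ ⟦ b ⟧)
⟦∧⟧ false b = refl

sum-mono-≤ : ∀ {n} {f g : Fin n → ℕ} → (∀ i → f i ≤ g i) → sum f ≤ sum g
sum-mono-≤ {zero}  f≤g = z≤n
sum-mono-≤ {suc n} f≤g = +-mono-≤ (f≤g zero) (sum-mono-≤ (f≤g ∘ suc))

sum-const : ∀ n c → sum {n} (λ _ → c) ≡ n * c
sum-const zero    c = refl
sum-const (suc n) c = cong (c +_) (sum-const n c)

VertexSet : ℕ → Set
VertexSet n = Fin n → Bool

∣_∣ : ∀ {n} → VertexSet n → ℕ
∣ S ∣ = sum (λ x → ⟦ S x ⟧)

∁ : ∀ {n} → VertexSet n → VertexSet n
∁ S x = not (S x)

_∩_ : ∀ {n} → VertexSet n → VertexSet n → VertexSet n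
(S ∩ T) x = S x ∧ T x

_∪_ : ∀ {n} → VertexSet n → VertexSet n → VertexSet n
(S ∪ T) x = S x ∨ T x

⁅_⁆ : ∀ {n} → Fin n → VertexSet n
⁅ z ⁆ x = does (x ≟ z)

insert : ∀ {n} → Fin n → VertexSet n → VertexSet n
insert z S = ⁅ z ⁆ ∪ S

⁅⁆-≢ : ∀ {n} {x z : Fin n} → x ≢ z → ⁅ z ⁆ x ≡ false
⁅⁆-≢ {x = x} {z} x≢z with x ≟ z
... | yes x≡z = ⊥-elim (x≢z x≡z)
... | no  _   = refl

⁅⁆-self : ∀ {n} (z : Fin n) → ⁅ z ⁆ z ≡ true
⁅⁆-self z with z ≟ z
... | yes _   = refl
... | no  z≢z = ⊥-elim (z≢z refl)

sum-⁅⁆ : ∀ {n} (z : Fin n) (g : Fin n → ℕ) → sum (λ x → ⟦ ⁅ z ⁆ x ⟧ * g x) ≡ g z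
sum-⁅⁆ {suc n} zero    g = begin
  1 * g zero + sum {n} (λ _ → 0) ≡⟨ cong₂ _+_ (*-identityˡ (g zero)) (sum-const n 0) ⟩
  g zero + n * 0                 ≡⟨ cong (g zero +_) (*-zeroʳ n) ⟩
  g zero + 0                     ≡⟨ +-identityʳ (g zero) ⟩
  g zero                         ∎
  where open ≡-Reasoning
sum-⁅⁆ {suc n} (suc z) g = sum-⁅⁆ z (g ∘ suc)

∣⁅⁆∣ : ∀ {n} (z : Fin n) → ∣ ⁅ z ⁆ ∣ ≡ 1
∣⁅⁆∣ z = trans (sum-cong-≗ (λ x → sym (*-identityʳ ⟦ ⁅ z ⁆ x ⟧))) (sum-⁅⁆ z (λ _ → 1))

∣∣+∣∁∣ : ∀ {n} (S : VertexSet n) → ∣ S ∣ + ∣ ∁ S ∣ ≡ n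
∣∣+∣∁∣ {n} S = begin
  ∣ S ∣ + ∣ ∁ S ∣                    ≡⟨ ∑-distrib-+ (λ x → ⟦ S x ⟧) (λ x → ⟦ ∁ S x ⟧) ⟨
  sum (λ x → ⟦ S x ⟧ + ⟦ ∁ S x ⟧)   ≡⟨ sum-cong-≗ (λ x → one (S x)) ⟩
  sum {n} (λ _ → 1)                  ≡⟨ sum-const n 1 ⟩
  n * 1                              ≡⟨ *-identityʳ n ⟩
  n                                  ∎
  where
    open ≡-Reasoning
    one : ∀ b → ⟦ b ⟧ + ⟦ not b ⟧ ≡ 1
    one true  = refl
    one false = refl

∣∣-remove : ∀ {n} (S : VertexSet n) {z} → S z ≡ true → ∣ S ∣ ≡ suc ∣ S ∩ ∁ ⁅ z ⁆ ∣
∣∣-remove S {z} Sz = begin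
  ∣ S ∣
    ≡⟨ sum-cong-≗ split ⟩
  sum (λ x → ⟦ ⁅ z ⁆ x ⟧ + ⟦ (S ∩ ∁ ⁅ z ⁆) x ⟧)
    ≡⟨ ∑-distrib-+ (λ x → ⟦ ⁅ z ⁆ x ⟧) (λ x → ⟦ (S ∩ ∁ ⁅ z ⁆) x ⟧) ⟩
  ∣ ⁅ z ⁆ ∣ + ∣ S ∩ ∁ ⁅ z ⁆ ∣
    ≡⟨ cong (_+ ∣ S ∩ ∁ ⁅ z ⁆ ∣) (∣⁅⁆∣ z) ⟩
  suc ∣ S ∩ ∁ ⁅ z ⁆ ∣
    ∎
  where
    open ≡-Reasoning
    split : ∀ x → ⟦ S x ⟧ ≡ ⟦ ⁅ z ⁆ x ⟧ + ⟦ S x ∧ not (⁅ z ⁆ x) ⟧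
    split x with x ≟ z
    ... | yes refl rewrite Sz = refl
    ... | no  _    = cong ⟦_⟧ (sym (∧-identityʳ (S x)))

insert-new : ∀ {n} (z : Fin n) (S : VertexSet n) → insert z S z ≡ true
insert-new z S = cong (_∨ S z) (⁅⁆-self z)

insert-old : ∀ {n} (z : Fin n) (S : VertexSet n) {x} → S x ≡ true → insert z S x ≡ true
insert-old z S {x} Sx = trans (cong (⁅ z ⁆ x ∨_) Sx) (∨-zeroʳ (⁅ z ⁆ x))

insert-outside : ∀ {n} {z : Fin n} (S : VertexSet n) {x} → x ≢ z → S x ≡ false → insert z S x ≡ false
insert-outside S x≢z Sx = cong₂ _∨_ (⁅⁆-≢ x≢z) Sx

⟦insert⟧ : ∀ {n} {z : Fin n} {S : VertexSet n} → S z ≡ false →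
  ∀ x → ⟦ insert z S x ⟧ ≡ ⟦ ⁅ z ⁆ x ⟧ + ⟦ S x ⟧
⟦insert⟧ {z = z} Sz x with x ≟ z
... | yes refl rewrite Sz = refl
... | no  _    = refl

∣insert∩∣ : ∀ {n} {z : Fin n} {S : VertexSet n} (T : VertexSet n) → S z ≡ false →
  ∣ insert z S ∩ T ∣ ≡ ⟦ T z ⟧ + ∣ S ∩ T ∣
∣insert∩∣ {z = z} {S} T Sz = begin
  ∣ insert z S ∩ T ∣
    ≡⟨ sum-cong-≗ split ⟩
  sum (λ x → ⟦ ⁅ z ⁆ x ⟧ * ⟦ T x ⟧ + ⟦ (S ∩ T) x ⟧)
    ≡⟨ ∑-distrib-+ (λ x → ⟦ ⁅ z ⁆ x ⟧ * ⟦ T x ⟧) (λ x → ⟦ (S ∩ T) x ⟧) ⟩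
  sum (λ x → ⟦ ⁅ z ⁆ x ⟧ * ⟦ T x ⟧) + ∣ S ∩ T ∣
    ≡⟨ cong (_+ ∣ S ∩ T ∣) (sum-⁅⁆ z (λ x → ⟦ T x ⟧)) ⟩
  ⟦ T z ⟧ + ∣ S ∩ T ∣
    ∎
  where
    open ≡-Reasoning
    split : ∀ x → ⟦ insert z S x ∧ T x ⟧ ≡ ⟦ ⁅ z ⁆ x ⟧ * ⟦ T x ⟧ + ⟦ S x ∧ T x ⟧
    split x = begin
      ⟦ insert z S x ∧ T x ⟧
        ≡⟨ ⟦∧⟧ (insert z S x) (T x) ⟩
      ⟦ insert z S x ⟧ * ⟦ T x ⟧
        ≡⟨ cong (_* ⟦ T x ⟧) (⟦insert⟧ Sz x) ⟩
      (⟦ ⁅ z ⁆ x ⟧ + ⟦ S x ⟧) * ⟦ T x ⟧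
        ≡⟨ *-distribʳ-+ ⟦ T x ⟧ ⟦ ⁅ z ⁆ x ⟧ ⟦ S x ⟧ ⟩
      ⟦ ⁅ z ⁆ x ⟧ * ⟦ T x ⟧ + ⟦ S x ⟧ * ⟦ T x ⟧
        ≡⟨ cong (⟦ ⁅ z ⁆ x ⟧ * ⟦ T x ⟧ +_) (⟦∧⟧ (S x) (T x)) ⟨
      ⟦ ⁅ z ⁆ x ⟧ * ⟦ T x ⟧ + ⟦ S x ∧ T x ⟧
        ∎

∣∁∣-insert : ∀ {n} {z : Fin n} {S : VertexSet n} → S z ≡ false → ∣ ∁ S ∣ ≡ suc ∣ ∁ (insert z S) ∣
∣∁∣-insert {z = z} {S} Sz =
  trans (∣∣-remove (∁ S) (cong not Sz)) (cong suc (sum-cong-≗ (λ x → cong ⟦_⟧ (not∧not (S x) (⁅ z ⁆ x)))))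
  where
    not∧not : ∀ a b → not a ∧ not b ≡ not (b ∨ a)
    not∧not true  true  = refl
    not∧not true  false = refl
    not∧not false true  = refl
    not∧not false false = refl

∣∁∣≡0⇒full : ∀ {n} (S : VertexSet n) → ∣ ∁ S ∣ ≡ 0 → ∀ x → S x ≡ true
∣∁∣≡0⇒full S ∣∁S∣≡0 x with S x in Sx
... | true  = refl
... | false = ⊥-elim (0≢1+n (trans (sym ∣∁S∣≡0) (∣∁∣-insert {S = S} Sx)))

∣∁∣≡suc⇒outside : ∀ {n} (S : VertexSet n) {k} → ∣ ∁ S ∣ ≡ suc k → ∃[ t ] S t ≡ false
∣∁∣≡suc⇒outside {suc n} S ∣∁S∣≡1+k with S zero in S0
... | false = zero , S0
... | true  = Product.map suc (λ St → St) (∣∁∣≡suc⇒outside (S ∘ suc) ∣∁S∣≡1+k)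

∣∁∣-insert-pred : ∀ {n} {z : Fin n} (S : VertexSet n) {k} → S z ≡ false → ∣ ∁ S ∣ ≡ suc k →
  ∣ ∁ (insert z S) ∣ ≡ k
∣∁∣-insert-pred S Sz ∣∁S∣≡1+k = suc-injective (trans (sym (∣∁∣-insert {S = S} Sz)) ∣∁S∣≡1+k)

∣∪∣+∣∩∣ : ∀ {n} (S T : VertexSet n) → ∣ S ∪ T ∣ + ∣ S ∩ T ∣ ≡ ∣ S ∣ + ∣ T ∣
∣∪∣+∣∩∣ S T = begin
  ∣ S ∪ T ∣ + ∣ S ∩ T ∣
    ≡⟨ ∑-distrib-+ (λ x → ⟦ (S ∪ T) x ⟧) (λ x → ⟦ (S ∩ T) x ⟧) ⟨
  sum (λ x → ⟦ S x ∨ T x ⟧ + ⟦ S x ∧ T x ⟧)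
    ≡⟨ sum-cong-≗ (λ x → pointwise (S x) (T x)) ⟩
  sum (λ x → ⟦ S x ⟧ + ⟦ T x ⟧)
    ≡⟨ ∑-distrib-+ (λ x → ⟦ S x ⟧) (λ x → ⟦ T x ⟧) ⟩
  ∣ S ∣ + ∣ T ∣
    ∎
  where
    open ≡-Reasoning
    pointwise : ∀ a b → ⟦ a ∨ b ⟧ + ⟦ a ∧ b ⟧ ≡ ⟦ a ⟧ + ⟦ b ⟧
    pointwise true  true  = refl
    pointwise true  false = refl
    pointwise false true  = refl
    pointwise false false = refl

length≤∣∣ : ∀ {n} {S : VertexSet n} {xs : List (Fin n)} →
  AllPairs _≢_ xs → All (λ x → S x ≡ true) xs → length xs ≤ ∣ S ∣
length≤∣∣ [] [] = z≤n
length≤∣∣ {S = S} {x ∷ xs} (x∉xs ∷ distinct) (Sx ∷ Sxs) =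
  subst (suc (length xs) ≤_) (sym (∣∣-remove S Sx))
    (s≤s (length≤∣∣ {S = S ∩ ∁ ⁅ x ⁆} distinct (All.zipWith still-in (x∉xs , Sxs))))
  where
    still-in : ∀ {y} → x ≢ y × S y ≡ true → S y ∧ not (⁅ x ⁆ y) ≡ true
    still-in {y} (x≢y , Sy) rewrite Sy | ⁅⁆-≢ (≢-sym x≢y) = refl

-- The handshake lemma

module _ {a p} {A : Set a} {P : Pred A p} (P? : Decidable P) where

  length-filter-tabulate : ∀ {n} (f : Fin n → A) →
    length (filter P? (tabulate f)) ≡ sum (λ i → ⟦ does (P? (f i)) ⟧)
  length-filter-tabulate {zero}  f = refl
  length-filter-tabulate {suc n} f with does (P? (f zero))
  ... | true  = cong suc (length-filter-tabulate (f ∘ suc))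
  ... | false = length-filter-tabulate (f ∘ suc)

  length-filter-concatMap : ∀ {b} {B : Set b} {n} (g : B → List A) (f : Fin n → B) →
    length (filter P? (concatMap g (tabulate f))) ≡ sum (λ i → length (filter P? (g (f i))))
  length-filter-concatMap {n = zero}  g f = refl
  length-filter-concatMap {n = suc n} g f = begin
    length (filter P? (g (f zero) ++ rest))
      ≡⟨ cong length (filter-++ P? (g (f zero)) rest) ⟩
    length (filter P? (g (f zero)) ++ filter P? rest)
      ≡⟨ length-++ (filter P? (g (f zero))) ⟩
    length (filter P? (g (f zero))) + length (filter P? rest)
      ≡⟨ cong (length (filter P? (g (f zero))) +_) (length-filter-concatMap g (f ∘ suc)) ⟩
    sum (λ i → length (filter P? (g (f i))))
      ∎
    where
      open ≡-Reasoning
      rest = concatMap g (tabulate (f ∘ suc))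

deg : ∀ {n} → Graph n → Fin n → ℕ
deg G x = ∣ adj G x ∣

degreeSum : ∀ {n} → Graph n → ℕ
degreeSum G = sum (deg G)

module _ {n} (G : Graph n) where

  forward : Fin n → Fin n → ℕ
  forward u v = ⟦ does (toℕ u <? toℕ v) ∧ adj G u v ⟧

  numEdges≡∑forward : numEdges G ≡ sum (λ u → sum (λ v → forward u v))
  numEdges≡∑forward = begin
    numEdges G
      ≡⟨ length-filter-concatMap Q? (λ u → map (u ,_) (tabulate (λ v → v))) (λ u → u) ⟩
    sum (λ u → length (filter Q? (map (u ,_) (tabulate (λ v → v)))))
      ≡⟨ sum-cong-≗ (λ u → cong (length ∘ filter Q?) (map-tabulate (λ v → v) (u ,_))) ⟩
    sum (λ u → length (filter Q? (tabulate (u ,_))))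
      ≡⟨ sum-cong-≗ (λ u → length-filter-tabulate Q? (u ,_)) ⟩
    sum (λ u → sum (λ v → ⟦ does (Q? (u , v)) ⟧))
      ≡⟨ sum-cong-≗ (λ u → sum-cong-≗ (λ v →
           cong (λ b → ⟦ does (toℕ u <? toℕ v) ∧ b ⟧) (does-≟true (adj G u v)))) ⟩
    sum (λ u → sum (λ v → forward u v))
      ∎
    where
      open ≡-Reasoning
      Q? : Decidable (λ (e : Fin n × Fin n) →
                        toℕ (proj₁ e) < toℕ (proj₂ e) × adj G (proj₁ e) (proj₂ e) ≡ true)
      Q? (u , v) = (toℕ u <? toℕ v) ×-dec (adj G u v ≟ᵇ true)
      does-≟true : ∀ b → does (b ≟ᵇ true) ≡ b
      does-≟true true  = refl
      does-≟true false = refl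

  adj≡forward+backward : ∀ u v → ⟦ adj G u v ⟧ ≡ forward u v + forward v u
  adj≡forward+backward u v with <-cmp (toℕ u) (toℕ v)
  ... | tri< u<v _ v≮u
    rewrite dec-true (toℕ u <? toℕ v) u<v | dec-false (toℕ v <? toℕ u) v≮u = sym (+-identityʳ _)
  ... | tri≈ _ u≡v _
    rewrite toℕ-injective u≡v | dec-false (toℕ v <? toℕ v) (n≮n (toℕ v)) = cong ⟦_⟧ (irrefl G v)
  ... | tri> u≮v _ v<u
    rewrite dec-false (toℕ u <? toℕ v) u≮v | dec-true (toℕ v <? toℕ u) v<u = cong ⟦_⟧ (Graph.sym G u v)

  handshake : degreeSum G ≡ 2 * numEdges G
  handshake = begin
    degreeSum G
      ≡⟨⟩
    sum (λ u → sum (λ v → ⟦ adj G u v ⟧))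
      ≡⟨ sum-cong-≗ (λ u → sum-cong-≗ (adj≡forward+backward u)) ⟩
    sum (λ u → sum (λ v → forward u v + forward v u))
      ≡⟨ sum-cong-≗ (λ u → ∑-distrib-+ (forward u) (λ v → forward v u)) ⟩
    sum (λ u → sum (forward u) + sum (λ v → forward v u))
      ≡⟨ ∑-distrib-+ (λ u → sum (forward u)) (λ u → sum (λ v → forward v u)) ⟩
    sum (λ u → sum (forward u)) + sum (λ u → sum (λ v → forward v u))
      ≡⟨ cong (sum (λ u → sum (forward u)) +_) (∑-comm (λ v u → forward v u)) ⟨
    sum (λ u → sum (forward u)) + sum (λ u → sum (forward u))
      ≡⟨ cong₂ _+_ numEdges≡∑forward numEdges≡∑forward ⟨
    numEdges G + numEdges G
      ≡⟨ cong (numEdges G +_) (+-identityʳ (numEdges G)) ⟨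
    2 * numEdges G
      ∎
    where open ≡-Reasoning

-- Growing a vertex set

TwoCommonNeighbours : ∀ {n} → Graph n → Fin n → Fin n → Set
TwoCommonNeighbours G u v = ∃[ w ] ∃[ w' ] (w ≢ w' × Adj G u w × Adj G v w × Adj G u w' × Adj G v w')

module _ {n} (G : Graph n) where

  adj⇒≢ : ∀ {a b} → Adj G a b → a ≢ b
  adj⇒≢ {a} ab refl = true≢false (trans (sym ab) (irrefl G a))

  adj-sym : ∀ {a b} → Adj G a b → Adj G b a
  adj-sym {a} {b} ab = trans (Graph.sym G b a) ab

  degIn : VertexSet n → Fin n → ℕ
  degIn S x = ∣ S ∩ adj G x ∣

  innerDegreeSum : VertexSet n → ℕ
  innerDegreeSum S = sum (λ x → ⟦ S x ⟧ * degIn S x)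

  potential : VertexSet n → ℕ
  potential S = innerDegreeSum S + 4 * ∣ ∁ S ∣

  innerDegreeSum-insert : ∀ {z S} → S z ≡ false →
    innerDegreeSum (insert z S) ≡ 2 * degIn S z + innerDegreeSum S
  innerDegreeSum-insert {z} {S} Sz = begin
    sum (λ x → ⟦ insert z S x ⟧ * degIn (insert z S) x)
      ≡⟨ sum-cong-≗ (λ x → cong₂ _*_ (⟦insert⟧ Sz x) (∣insert∩∣ (adj G x) Sz)) ⟩
    sum (λ x → (⟦ ⁅ z ⁆ x ⟧ + ⟦ S x ⟧) * (⟦ adj G x z ⟧ + degIn S x))
      ≡⟨ sum-cong-≗ (λ x → expand ⟦ ⁅ z ⁆ x ⟧ ⟦ S x ⟧ ⟦ adj G x z ⟧ (degIn S x)) ⟩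
    sum (λ x → ⟦ ⁅ z ⁆ x ⟧ * (⟦ adj G x z ⟧ + degIn S x) + (⟦ S x ⟧ * ⟦ adj G x z ⟧ + ⟦ S x ⟧ * degIn S x))
      ≡⟨ ∑-distrib-+ (λ x → ⟦ ⁅ z ⁆ x ⟧ * (⟦ adj G x z ⟧ + degIn S x)) _ ⟩
    sum (λ x → ⟦ ⁅ z ⁆ x ⟧ * (⟦ adj G x z ⟧ + degIn S x))
      + sum (λ x → ⟦ S x ⟧ * ⟦ adj G x z ⟧ + ⟦ S x ⟧ * degIn S x)
      ≡⟨ cong₂ _+_ (sum-⁅⁆ z (λ x → ⟦ adj G x z ⟧ + degIn S x))
                   (∑-distrib-+ (λ x → ⟦ S x ⟧ * ⟦ adj G x z ⟧) _) ⟩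
    (⟦ adj G z z ⟧ + degIn S z) + (sum (λ x → ⟦ S x ⟧ * ⟦ adj G x z ⟧) + innerDegreeSum S)
      ≡⟨ cong₂ (λ a b → (⟦ a ⟧ + degIn S z) + (b + innerDegreeSum S)) (irrefl G z) (sum-cong-≗ back-edges) ⟩
    degIn S z + (degIn S z + innerDegreeSum S)
      ≡⟨ regroup (degIn S z) (innerDegreeSum S) ⟩
    2 * degIn S z + innerDegreeSum S
      ∎
    where
      open ≡-Reasoning
      expand : ∀ a b c d → (a + b) * (c + d) ≡ a * (c + d) + (b * c + b * d)
      expand = solve-∀
      regroup : ∀ d i → d + (d + i) ≡ 2 * d + i
      regroup = solve-∀
      back-edges : ∀ x → ⟦ S x ⟧ * ⟦ adj G x z ⟧ ≡ ⟦ S x ∧ adj G z x ⟧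
      back-edges x = trans (cong (λ b → ⟦ S x ⟧ * ⟦ b ⟧) (Graph.sym G x z)) (sym (⟦∧⟧ (S x) (adj G z x)))

  potential-insert : ∀ {z S} → S z ≡ false → potential S + 2 * degIn S z ≡ potential (insert z S) + 4
  potential-insert {z} {S} Sz = begin
    innerDegreeSum S + 4 * ∣ ∁ S ∣ + 2 * degIn S z
      ≡⟨ cong (λ c → innerDegreeSum S + 4 * c + 2 * degIn S z) (∣∁∣-insert {S = S} Sz) ⟩
    innerDegreeSum S + 4 * suc ∣ ∁ (insert z S) ∣ + 2 * degIn S z
      ≡⟨ regroup (innerDegreeSum S) ∣ ∁ (insert z S) ∣ (degIn S z) ⟩
    (2 * degIn S z + innerDegreeSum S) + 4 * ∣ ∁ (insert z S) ∣ + 4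
      ≡⟨ cong (λ i → i + 4 * ∣ ∁ (insert z S) ∣ + 4) (innerDegreeSum-insert Sz) ⟨
    potential (insert z S) + 4
      ∎
    where
      open ≡-Reasoning
      regroup : ∀ i c d → i + 4 * suc c + 2 * d ≡ (2 * d + i) + 4 * c + 4
      regroup = solve-∀

  potential-full : ∀ {S} → (∀ x → S x ≡ true) → potential S ≡ degreeSum G
  potential-full {S} full = begin
    innerDegreeSum S + 4 * ∣ ∁ S ∣ ≡⟨ cong₂ (λ i c → i + 4 * c) (sum-cong-≗ all-neighbours) no-outside ⟩
    degreeSum G + 4 * 0            ≡⟨ +-identityʳ (degreeSum G) ⟩
    degreeSum G                    ∎
    where
      open ≡-Reasoning
      all-neighbours : ∀ x → ⟦ S x ⟧ * degIn S x ≡ deg G x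
      all-neighbours x rewrite full x =
        trans (+-identityʳ (degIn S x)) (sum-cong-≗ (λ y → cong (λ b → ⟦ b ∧ adj G x y ⟧) (full y)))
      no-outside : ∣ ∁ S ∣ ≡ 0
      no-outside = trans (sum-cong-≗ (λ x → cong (λ b → ⟦ not b ⟧) (full x))) (trans (sum-const n 0) (*-zeroʳ n))

  potential-insert-≥ : ∀ {z S j} → S z ≡ false → j ≤ degIn S z → potential S + 2 * j ≤ potential (insert z S) + 4
  potential-insert-≥ {S = S} Sz j≤d =
    ≤-trans (+-monoʳ-≤ (potential S) (*-monoʳ-≤ 2 j≤d)) (≤-reflexive (potential-insert Sz))

  potential-insert-≥1 : ∀ {z S} → S z ≡ false → 1 ≤ degIn S z → potential S ≤ potential (insert z S) + 2
  potential-insert-≥1 {z} {S} Sz 1≤d = +-cancelʳ-≤ 2 (potential S) (potential (insert z S) + 2)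
    (≤-trans (potential-insert-≥ Sz 1≤d) (≤-reflexive (sym (+-assoc (potential (insert z S)) 2 2))))

  potential-insert-≥2 : ∀ {z S} → S z ≡ false → 2 ≤ degIn S z → potential S ≤ potential (insert z S)
  potential-insert-≥2 {z} {S} Sz 2≤d = +-cancelʳ-≤ 4 (potential S) (potential (insert z S)) (potential-insert-≥ Sz 2≤d)

  potential-insert-≥3 : ∀ {z S} → S z ≡ false → 3 ≤ degIn S z → potential S + 2 ≤ potential (insert z S)
  potential-insert-≥3 {z} {S} Sz 3≤d = +-cancelʳ-≤ 4 (potential S + 2) (potential (insert z S))
    (≤-trans (≤-reflexive (+-assoc (potential S) 2 4)) (potential-insert-≥ Sz 3≤d))

  crossing-edge : ∀ (S : VertexSet n) {s t} → Walk G s t → S s ≡ true → S t ≡ false →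
    ∃[ a ] ∃[ b ] (S a ≡ true × S b ≡ false × Adj G a b)
  crossing-edge S here Ss St = ⊥-elim (true≢false (trans (sym Ss) St))
  crossing-edge S {s} (step {w = w} sw walk) Ss St with S w in Sw
  ... | true  = crossing-edge S walk Sw St
  ... | false = s , w , Ss , Sw , sw

module Growth {n} {G : Graph n} (connected : Connected G) (cover : Cover32 G) where

  potential≤degreeSum : ∀ k S {s} → ∣ ∁ S ∣ ≡ k → S s ≡ true → potential G S ≤ degreeSum G
  potential+2≤degreeSum : ∀ k S {z p q} → ∣ ∁ S ∣ ≡ k → S z ≡ false → S p ≡ true → S q ≡ true →
    p ≢ q → Adj G z p → Adj G z q → potential G S + 2 ≤ degreeSum G

  potential≤degreeSum zero S ∣∁S∣≡0 _ = ≤-reflexive (potential-full G (∣∁∣≡0⇒full S ∣∁S∣≡0))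
  potential≤degreeSum (suc k) S {s} ∣∁S∣≡1+k Ss with ∣∁∣≡suc⇒outside S ∣∁S∣≡1+k
  ... | t , St with crossing-edge G S (connected s t) Ss St
  ... | a , b , Sa , Sb , ab = by-common-neighbour (cover a b ab)
    where
      S' = insert b S
      ∣∁S'∣≡k : ∣ ∁ S' ∣ ≡ k
      ∣∁S'∣≡k = ∣∁∣-insert-pred S Sb ∣∁S∣≡1+k
      by-common-neighbour : TwoCommonNeighbours G a b → potential G S ≤ degreeSum G
      by-common-neighbour (w , _ , _ , aw , bw , _) with S w in Sw
      ... | true  = ≤-trans (potential-insert-≥2 G Sb b-has-two)
                      (potential≤degreeSum k S' ∣∁S'∣≡k (insert-new b S))
        where
          b-has-two : 2 ≤ degIn G S b
          b-has-two = length≤∣∣ {S = S ∩ adj G b} ((adj⇒≢ G aw ∷ []) ∷ [] ∷ [])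
            (cong₂ _∧_ Sa (adj-sym G ab) ∷ cong₂ _∧_ Sw bw ∷ [])
      ... | false = ≤-trans (potential-insert-≥1 G Sb b-has-one)
                      (potential+2≤degreeSum k S' ∣∁S'∣≡k (insert-outside S (≢-sym (adj⇒≢ G bw)) Sw)
                        (insert-old b S Sa) (insert-new b S) (adj⇒≢ G ab) (adj-sym G aw) (adj-sym G bw))
        where
          b-has-one : 1 ≤ degIn G S b
          b-has-one = length≤∣∣ {S = S ∩ adj G b} ([] ∷ []) (cong₂ _∧_ Sa (adj-sym G ab) ∷ [])

  potential+2≤degreeSum zero S ∣∁S∣≡0 Sz _ _ _ _ _ =
    ⊥-elim (0≢1+n (trans (sym ∣∁S∣≡0) (∣∁∣-insert {S = S} Sz)))
  potential+2≤degreeSum (suc k) S {z} {p} {q} ∣∁S∣≡1+k Sz Sp Sq p≢q zp zq = by-common-neighbours (cover z p zp)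
    where
      S' = insert z S
      ∣∁S'∣≡k : ∣ ∁ S' ∣ ≡ k
      ∣∁S'∣≡k = ∣∁∣-insert-pred S Sz ∣∁S∣≡1+k
      via-outside : ∀ {y} → S y ≡ false → Adj G z y → Adj G p y → potential G S + 2 ≤ degreeSum G
      via-outside Sy zy py = ≤-trans (+-monoˡ-≤ 2 (potential-insert-≥2 G Sz z-has-two))
        (potential+2≤degreeSum k S' ∣∁S'∣≡k (insert-outside S (≢-sym (adj⇒≢ G zy)) Sy) (insert-new z S)
          (insert-old z S Sp) (adj⇒≢ G zp) (adj-sym G zy) (adj-sym G py))
        where
          z-has-two : 2 ≤ degIn G S z
          z-has-two = length≤∣∣ {S = S ∩ adj G z} ((p≢q ∷ []) ∷ [] ∷ [])
            (cong₂ _∧_ Sp zp ∷ cong₂ _∧_ Sq zq ∷ [])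
      by-common-neighbours : TwoCommonNeighbours G z p → potential G S + 2 ≤ degreeSum G
      by-common-neighbours (y , y' , y≢y' , zy , py , zy' , py') with S y in Sy | S y' in Sy'
      ... | false | _     = via-outside Sy zy py
      ... | true  | false = via-outside Sy' zy' py'
      ... | true  | true  = ≤-trans (potential-insert-≥3 G Sz z-has-three)
                              (potential≤degreeSum k S' ∣∁S'∣≡k (insert-old z S Sp))
        where
          z-has-three : 3 ≤ degIn G S z
          z-has-three = length≤∣∣ {S = S ∩ adj G z}
            ((adj⇒≢ G py ∷ adj⇒≢ G py' ∷ []) ∷ (y≢y' ∷ []) ∷ [] ∷ [])
            (cong₂ _∧_ Sp zp ∷ cong₂ _∧_ Sy zy ∷ cong₂ _∧_ Sy' zy' ∷ [])

-- An edge in no K₄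

K4Through : ∀ {n} → Graph n → Fin n → Fin n → Set
K4Through G u v = ∃[ w ] ∃[ x ] (Adj G w x × Adj G u w × Adj G v w × Adj G u x × Adj G v x)

Cover41⇒Cover32 : ∀ {n} {H : Graph n} → Cover41 H → Cover32 H
Cover41⇒Cover32 {H = H} cover41 u v uv with cover41 u v uv
... | w , x , wx , uw , vw , ux , vx = w , x , adj⇒≢ H wx , uw , vw , ux , vx

K4Through? : ∀ {n} (G : Graph n) u v → Dec (K4Through G u v)
K4Through? G u v = any? λ w → any? λ x → (adj G w x ≟ᵇ true) ×-dec (adj G u w ≟ᵇ true) ×-dec
  (adj G v w ≟ᵇ true) ×-dec (adj G u x ≟ᵇ true) ×-dec (adj G v x ≟ᵇ true)

other-common-neighbour : ∀ {n} (G : Graph n) → Cover32 G → ∀ {p q} → Adj G p q → (t : Fin n) →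
  ∃[ a ] (a ≢ t × Adj G p a × Adj G q a)
other-common-neighbour G cover pq t with cover _ _ pq
... | w , w' , w≢w' , pw , qw , pw' , qw' with w ≟ t
... | yes refl = w' , ≢-sym w≢w' , pw' , qw'
... | no  w≢t  = w , w≢t , pw , qw

module NoK4Edge {n} {G : Graph n} (connected : Connected G) (cover : Cover32 G)
                {u v} (uv : Adj G u v) (noK4 : ¬ K4Through G u v) where

  N : VertexSet n
  N = adj G u ∪ adj G v

  W : VertexSet n
  W = adj G u ∩ adj G v

  need : Fin n → ℕ
  need x = 3 + ⟦ W x ⟧

  N-u : ∀ {y} → Adj G u y → N y ≡ true
  N-u {y} uy = cong (_∨ adj G v y) uy

  N-v : ∀ {y} → Adj G v y → N y ≡ true
  N-v {y} vy = trans (cong (adj G u y ∨_) vy) (∨-zeroʳ (adj G u y))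

  W-member : ∀ {y} → Adj G u y → Adj G v y → W y ≡ true
  W-member = cong₂ _∧_

  W-nonmember : ∀ {y} → adj G v y ≡ false → W y ≡ false
  W-nonmember {y} vy = trans (cong (adj G u y ∧_) vy) (∧-zeroʳ (adj G u y))

  u≢v : u ≢ v
  u≢v = adj⇒≢ G uv

  -- otherwise w and x would be adjacent common neighbours of u and v
  v-nonadjacent : ∀ {w x} → Adj G u w → Adj G v w → Adj G w x → Adj G u x → adj G v x ≡ false
  v-nonadjacent {w} {x} uw vw wx ux with adj G v x in vx
  ... | true  = ⊥-elim (noK4 (w , x , wx , uw , vw , ux , vx))
  ... | false = refl

  three-neighbours : ∀ {s x} → N s ≡ true → (∀ {y} → Adj G s y → N y ≡ true) → Adj G s x → 3 ≤ degIn G N x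
  three-neighbours {s} {x} Ns N-s sx with cover s x sx
  ... | y , y' , y≢y' , sy , xy , sy' , xy' = length≤∣∣ {S = N ∩ adj G x}
    ((adj⇒≢ G sy ∷ adj⇒≢ G sy' ∷ []) ∷ (y≢y' ∷ []) ∷ [] ∷ [])
    (cong₂ _∧_ Ns (adj-sym G sx) ∷ cong₂ _∧_ (N-s sy) xy ∷ cong₂ _∧_ (N-s sy') xy' ∷ [])

  four-neighbours : ∀ {x} → Adj G u x → Adj G v x → 4 ≤ degIn G N x
  four-neighbours {x} ux vx with other-common-neighbour G cover ux v | other-common-neighbour G cover vx u
  ... | a , a≢v , ua , xa | c , c≢u , vc , xc = length≤∣∣ {S = N ∩ adj G x}
    ((u≢v ∷ adj⇒≢ G ua ∷ ≢-sym c≢u ∷ []) ∷ (≢-sym a≢v ∷ adj⇒≢ G vc ∷ []) ∷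
     (a≢c ∷ []) ∷ [] ∷ [])
    (cong₂ _∧_ (N-v (adj-sym G uv)) (adj-sym G ux) ∷ cong₂ _∧_ (N-u uv) (adj-sym G vx) ∷
     cong₂ _∧_ (N-u ua) xa ∷ cong₂ _∧_ (N-v vc) xc ∷ [])
    where
      a≢c : a ≢ c
      a≢c refl = true≢false (trans (sym vc) (v-nonadjacent ux vx xa ua))

  need≤degIn : ∀ x → N x ≡ true → need x ≤ degIn G N x
  need≤degIn x Nx with adj G u x in ux | adj G v x in vx
  ... | true  | true  = four-neighbours ux vx
  ... | true  | false = three-neighbours (N-v (adj-sym G uv)) N-u ux
  ... | false | true  = three-neighbours (N-u uv) N-v vx
  need≤degIn x () | false | false

  W-outside : ∀ {x} → N x ≡ false → W x ≡ false
  W-outside {x} Nx with adj G u x | adj G v x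
  W-outside () | true  | _
  W-outside () | false | true
  ... | false | false = refl

  deg≤degIn : ∀ {s} → (∀ {y} → Adj G s y → N y ≡ true) → deg G s ≤ degIn G N s
  deg≤degIn {s} N-s = sum-mono-≤ pointwise
    where
      pointwise : ∀ y → ⟦ adj G s y ⟧ ≤ ⟦ N y ∧ adj G s y ⟧
      pointwise y with adj G s y in sy
      ... | true  = subst (λ b → 1 ≤ ⟦ b ∧ true ⟧) (sym (N-s sy)) ≤-refl
      ... | false = z≤n

  two-common-neighbours : 2 ≤ ∣ W ∣
  two-common-neighbours with cover u v uv
  ... | w , w' , w≢w' , uw , vw , uw' , vw' =
    length≤∣∣ {S = W} ((w≢w' ∷ []) ∷ [] ∷ []) (cong₂ _∧_ uw vw ∷ cong₂ _∧_ uw' vw' ∷ [])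

  -- Summing charge ≤ capacity over all vertices, with deg u + deg v = |N| + |W| and |W| ≥ 2,
  -- gives 2e(N) ≥ 4|N| − 2 + Σ β.
  module Discharge (β : Fin n → ℕ) (β-u : β u ≡ 0) (β-v : β v ≡ 0)
                   (β-outside : ∀ x → N x ≡ false → β x ≡ 0)
                   (β-inside : ∀ x → x ≢ u → x ≢ v → N x ≡ true → need x + β x ≤ degIn G N x) where

    charge : Fin n → ℕ
    charge x = 3 * ⟦ N x ⟧ + ⟦ W x ⟧ + β x + (⟦ ⁅ u ⁆ x ⟧ * deg G u + ⟦ ⁅ v ⁆ x ⟧ * deg G v)

    capacity : Fin n → ℕ
    capacity x = ⟦ N x ⟧ * degIn G N x + (⟦ ⁅ u ⁆ x ⟧ * 3 + ⟦ ⁅ v ⁆ x ⟧ * 3)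

    inner-charge : ∀ x → x ≢ u → x ≢ v → 3 * ⟦ N x ⟧ + ⟦ W x ⟧ + β x ≤ ⟦ N x ⟧ * degIn G N x
    inner-charge x x≢u x≢v with N x in Nx
    ... | true  = subst (need x + β x ≤_) (sym (+-identityʳ _)) (β-inside x x≢u x≢v Nx)
    ... | false rewrite W-outside Nx | β-outside x Nx = z≤n

    endpoint-charge : ∀ {s} → N s ≡ true → W s ≡ false → β s ≡ 0 → (∀ {y} → Adj G s y → N y ≡ true) →
      3 * ⟦ N s ⟧ + ⟦ W s ⟧ + β s + deg G s ≤ ⟦ N s ⟧ * degIn G N s + 3
    endpoint-charge {s} Ns Ws βs N-s rewrite Ns | Ws | βs =
      ≤-trans (≤-reflexive (+-comm 3 (deg G s)))
        (+-monoˡ-≤ 3 (≤-trans (deg≤degIn N-s) (≤-reflexive (sym (+-identityʳ (degIn G N s))))))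

    charge≤capacity : ∀ x → charge x ≤ capacity x
    charge≤capacity x with x ≟ u | x ≟ v
    ... | yes refl | yes u≡v = ⊥-elim (u≢v u≡v)
    ... | yes refl | no  _ =
      ≤-trans (≤-reflexive (cong (3 * ⟦ N u ⟧ + ⟦ W u ⟧ + β u +_) (trans (+-identityʳ _) (*-identityˡ (deg G u)))))
        (endpoint-charge (N-v (adj-sym G uv)) (cong (_∧ adj G v u) (irrefl G u)) β-u N-u)
    ... | no  _    | yes refl =
      ≤-trans (≤-reflexive (cong (3 * ⟦ N v ⟧ + ⟦ W v ⟧ + β v +_) (*-identityˡ (deg G v))))
        (endpoint-charge (N-u uv) (W-nonmember (irrefl G v)) β-v N-v)
    ... | no  x≢u  | no  x≢v = +-monoˡ-≤ 0 (inner-charge x x≢u x≢v)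

    total-charge : sum charge ≡ 3 * ∣ N ∣ + ∣ W ∣ + sum β + (deg G u + deg G v)
    total-charge = begin
      sum charge
        ≡⟨ ∑-distrib-+ (λ x → 3 * ⟦ N x ⟧ + ⟦ W x ⟧ + β x) at-endpoints ⟩
      sum (λ x → 3 * ⟦ N x ⟧ + ⟦ W x ⟧ + β x) + sum at-endpoints
        ≡⟨ cong₂ _+_ (∑-distrib-+ (λ x → 3 * ⟦ N x ⟧ + ⟦ W x ⟧) β)
                     (∑-distrib-+ (λ x → ⟦ ⁅ u ⁆ x ⟧ * deg G u) (λ x → ⟦ ⁅ v ⁆ x ⟧ * deg G v)) ⟩
      sum (λ x → 3 * ⟦ N x ⟧ + ⟦ W x ⟧) + sum β
        + (sum (λ x → ⟦ ⁅ u ⁆ x ⟧ * deg G u) + sum (λ x → ⟦ ⁅ v ⁆ x ⟧ * deg G v))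
        ≡⟨ cong₂ (λ a b → a + sum β + b) (∑-distrib-+ (λ x → 3 * ⟦ N x ⟧) (λ x → ⟦ W x ⟧))
                 (cong₂ _+_ (sum-⁅⁆ u (λ _ → deg G u)) (sum-⁅⁆ v (λ _ → deg G v))) ⟩
      sum (λ x → 3 * ⟦ N x ⟧) + ∣ W ∣ + sum β + (deg G u + deg G v)
        ≡⟨ cong (λ a → a + ∣ W ∣ + sum β + (deg G u + deg G v)) (*-distribˡ-sum 3 (λ x → ⟦ N x ⟧)) ⟨
      3 * ∣ N ∣ + ∣ W ∣ + sum β + (deg G u + deg G v)
        ∎
      where
        open ≡-Reasoning
        at-endpoints : Fin n → ℕ
        at-endpoints x = ⟦ ⁅ u ⁆ x ⟧ * deg G u + ⟦ ⁅ v ⁆ x ⟧ * deg G v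

    total-capacity : sum capacity ≡ innerDegreeSum G N + 6
    total-capacity = begin
      sum capacity
        ≡⟨ ∑-distrib-+ (λ x → ⟦ N x ⟧ * degIn G N x) (λ x → ⟦ ⁅ u ⁆ x ⟧ * 3 + ⟦ ⁅ v ⁆ x ⟧ * 3) ⟩
      innerDegreeSum G N + sum (λ x → ⟦ ⁅ u ⁆ x ⟧ * 3 + ⟦ ⁅ v ⁆ x ⟧ * 3)
        ≡⟨ cong (innerDegreeSum G N +_) (∑-distrib-+ (λ x → ⟦ ⁅ u ⁆ x ⟧ * 3) (λ x → ⟦ ⁅ v ⁆ x ⟧ * 3)) ⟩
      innerDegreeSum G N + (sum (λ x → ⟦ ⁅ u ⁆ x ⟧ * 3) + sum (λ x → ⟦ ⁅ v ⁆ x ⟧ * 3))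
        ≡⟨ cong (innerDegreeSum G N +_) (cong₂ _+_ (sum-⁅⁆ u (λ _ → 3)) (sum-⁅⁆ v (λ _ → 3))) ⟩
      innerDegreeSum G N + 6
        ∎
      where open ≡-Reasoning

    discharge : 4 * ∣ N ∣ + sum β ≤ innerDegreeSum G N + 2
    discharge = +-cancelʳ-≤ 4 (4 * ∣ N ∣ + sum β) (innerDegreeSum G N + 2) (begin
      4 * ∣ N ∣ + sum β + 4
        ≤⟨ +-monoʳ-≤ (4 * ∣ N ∣ + sum β) (*-monoʳ-≤ 2 two-common-neighbours) ⟩
      4 * ∣ N ∣ + sum β + 2 * ∣ W ∣
        ≡⟨ rearrange ∣ N ∣ ∣ W ∣ (sum β) ⟩
      3 * ∣ N ∣ + ∣ W ∣ + sum β + (∣ N ∣ + ∣ W ∣)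
        ≡⟨ cong (3 * ∣ N ∣ + ∣ W ∣ + sum β +_) (∣∪∣+∣∩∣ (adj G u) (adj G v)) ⟩
      3 * ∣ N ∣ + ∣ W ∣ + sum β + (deg G u + deg G v)
        ≡⟨ total-charge ⟨
      sum charge
        ≤⟨ sum-mono-≤ charge≤capacity ⟩
      sum capacity
        ≡⟨ total-capacity ⟩
      innerDegreeSum G N + 6
        ≡⟨ +-assoc (innerDegreeSum G N) 2 4 ⟨
      innerDegreeSum G N + 2 + 4
        ∎)
      where
        open ≤-Reasoning
        rearrange : ∀ a w b → 4 * a + b + 2 * w ≡ 3 * a + w + b + (a + w)
        rearrange = solve-∀

  open Growth connected cover

  potential-lower : ∀ b → 4 * ∣ N ∣ + b ≤ innerDegreeSum G N + 2 → 4 * n + b ≤ potential G N + 2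
  potential-lower b bound = begin
    4 * n + b                                  ≡⟨ cong (λ m → 4 * m + b) (∣∣+∣∁∣ N) ⟨
    4 * (∣ N ∣ + ∣ ∁ N ∣) + b                  ≡⟨ split-off ∣ N ∣ ∣ ∁ N ∣ b ⟩
    (4 * ∣ N ∣ + b) + 4 * ∣ ∁ N ∣              ≤⟨ +-monoˡ-≤ (4 * ∣ ∁ N ∣) bound ⟩
    innerDegreeSum G N + 2 + 4 * ∣ ∁ N ∣       ≡⟨ swap-last (innerDegreeSum G N) ∣ ∁ N ∣ ⟩
    potential G N + 2                          ∎
    where
      open ≤-Reasoning
      split-off : ∀ a c b → 4 * (a + c) + b ≡ (4 * a + b) + 4 * c
      split-off = solve-∀
      swap-last : ∀ i c → i + 2 + 4 * c ≡ i + 4 * c + 2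
      swap-last = solve-∀

  dense-via-escape : ∀ {z p q} → N z ≡ false → N p ≡ true → N q ≡ true → p ≢ q → Adj G z p → Adj G z q →
    4 * n ≤ degreeSum G + 1
  dense-via-escape Nz Np Nq p≢q zp zq = begin
    4 * n                                   ≤⟨ m≤m+n (4 * n) _ ⟩
    4 * n + sum {n} (λ _ → 0)
      ≤⟨ potential-lower _ (Discharge.discharge (λ _ → 0) refl refl (λ _ _ → refl) no-bonus) ⟩
    potential G N + 2                       ≤⟨ potential+2≤degreeSum ∣ ∁ N ∣ N refl Nz Np Nq p≢q zp zq ⟩
    degreeSum G                             ≤⟨ m≤m+n (degreeSum G) 1 ⟩
    degreeSum G + 1                         ∎
    where
      open ≤-Reasoning
      no-bonus : ∀ x → x ≢ u → x ≢ v → N x ≡ true → need x + 0 ≤ degIn G N x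
      no-bonus x _ _ Nx = subst (_≤ degIn G N x) (sym (+-identityʳ (need x))) (need≤degIn x Nx)

  dense-via-bonus : ∀ {t} → t ≢ u → t ≢ v → N t ≡ true → need t + 1 ≤ degIn G N t → 4 * n ≤ degreeSum G + 1
  dense-via-bonus {t} t≢u t≢v Nt extra = +-cancelʳ-≤ 1 (4 * n) (degreeSum G + 1) (begin
    4 * n + 1                               ≡⟨ cong (4 * n +_) (∣⁅⁆∣ t) ⟨
    4 * n + ∣ ⁅ t ⁆ ∣
      ≤⟨ potential-lower _ (Discharge.discharge β β-u β-v β-outside β-inside) ⟩
    potential G N + 2                       ≤⟨ +-monoˡ-≤ 2 (potential≤degreeSum ∣ ∁ N ∣ N refl (N-u uv)) ⟩
    degreeSum G + 2                         ≡⟨ +-assoc (degreeSum G) 1 1 ⟨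
    degreeSum G + 1 + 1                     ∎)
    where
      open ≤-Reasoning
      β : Fin n → ℕ
      β x = ⟦ ⁅ t ⁆ x ⟧
      β-u : β u ≡ 0
      β-u = cong ⟦_⟧ (⁅⁆-≢ (≢-sym t≢u))
      β-v : β v ≡ 0
      β-v = cong ⟦_⟧ (⁅⁆-≢ (≢-sym t≢v))
      β-outside : ∀ x → N x ≡ false → β x ≡ 0
      β-outside x Nx = cong ⟦_⟧ (⁅⁆-≢ {x = x} λ { refl → true≢false (trans (sym Nt) Nx) })
      β-inside : ∀ x → x ≢ u → x ≢ v → N x ≡ true → need x + β x ≤ degIn G N x
      β-inside x _ _ Nx with x ≟ t
      ... | yes refl = extra
      ... | no  _    = subst (_≤ degIn G N x) (sym (+-identityʳ (need x))) (need≤degIn x Nx)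

  -- w is a common neighbour of u and v, a one of u and w, c one of v and w.  A common neighbour
  -- z ≠ u of w and a lies outside N, or is c and gives a a fourth neighbour in N, or gives w a fifth.
  module _ {w a c} (uw : Adj G u w) (vw : Adj G v w) (ua : Adj G u a) (wa : Adj G w a) (a≢v : a ≢ v)
           (vc : Adj G v c) (wc : Adj G w c) (c≢u : c ≢ u) where

    va-false : adj G v a ≡ false
    va-false = v-nonadjacent uw vw wa ua

    a≢c : a ≢ c
    a≢c refl = true≢false (trans (sym vc) va-false)

    bonus-at-a : Adj G a c → need a + 1 ≤ degIn G N a
    bonus-at-a ac with other-common-neighbour G cover ua w
    ... | a' , a'≢w , ua' , aa' = subst (λ b → 3 + ⟦ b ⟧ + 1 ≤ degIn G N a) (sym (W-nonmember va-false))
      (length≤∣∣ {S = N ∩ adj G a}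
        ((adj⇒≢ G uw ∷ adj⇒≢ G ua' ∷ ≢-sym c≢u ∷ []) ∷ (≢-sym a'≢w ∷ adj⇒≢ G wc ∷ []) ∷
         (a'≢c ∷ []) ∷ [] ∷ [])
        (cong₂ _∧_ (N-v (adj-sym G uv)) (adj-sym G ua) ∷ cong₂ _∧_ (N-u uw) (adj-sym G wa) ∷
         cong₂ _∧_ (N-u ua') aa' ∷ cong₂ _∧_ (N-v vc) ac ∷ []))
      where
        a'≢c : a' ≢ c
        a'≢c refl = true≢false (trans (sym vc) (v-nonadjacent uw vw wc ua'))

    bonus-at-w : ∀ {z} → z ≢ u → z ≢ c → N z ≡ true → Adj G w z → Adj G a z → need w + 1 ≤ degIn G N w
    bonus-at-w {z} z≢u z≢c Nz wz az = subst (λ b → 3 + ⟦ b ⟧ + 1 ≤ degIn G N w) (sym (W-member uw vw))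
      (length≤∣∣ {S = N ∩ adj G w}
        ((u≢v ∷ adj⇒≢ G ua ∷ ≢-sym c≢u ∷ ≢-sym z≢u ∷ []) ∷
         (≢-sym a≢v ∷ adj⇒≢ G vc ∷ v≢z ∷ []) ∷
         (a≢c ∷ adj⇒≢ G az ∷ []) ∷ (≢-sym z≢c ∷ []) ∷ [] ∷ [])
        (cong₂ _∧_ (N-v (adj-sym G uv)) (adj-sym G uw) ∷ cong₂ _∧_ (N-u uv) (adj-sym G vw) ∷
         cong₂ _∧_ (N-u ua) wa ∷ cong₂ _∧_ (N-v vc) wc ∷ cong₂ _∧_ Nz wz ∷ []))
      where
        v≢z : v ≢ z
        v≢z refl = true≢false (trans (sym (adj-sym G az)) va-false)

    dense-from-configuration : 4 * n ≤ degreeSum G + 1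
    dense-from-configuration with other-common-neighbour G cover wa u
    ... | z , z≢u , wz , az with N z in Nz
    ... | false = dense-via-escape Nz (N-u uw) (N-u ua) (adj⇒≢ G wa) (adj-sym G wz) (adj-sym G az)
    ... | true with z ≟ c
    ...   | yes refl = dense-via-bonus (≢-sym (adj⇒≢ G ua)) a≢v (N-u ua) (bonus-at-a az)
    ...   | no  z≢c  = dense-via-bonus (≢-sym (adj⇒≢ G uw)) (≢-sym (adj⇒≢ G vw)) (N-u uw)
                           (bonus-at-w z≢u z≢c Nz wz az)

  dense : 4 * n ≤ degreeSum G + 1
  dense with cover u v uv
  ... | w , _ , _ , uw , vw , _ with other-common-neighbour G cover uw v | other-common-neighbour G cover vw u
  ... | a , a≢v , ua , wa | c , c≢u , vc , wc = dense-from-configuration uw vw ua wa a≢v vc wc c≢u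

-- Sparse connected graphs with a (3,2)-cover

_++ʷ_ : ∀ {n} {G : Graph n} {x y z} → Walk G x y → Walk G y z → Walk G x z
here       ++ʷ q = q
step xw p  ++ʷ q = step xw (p ++ʷ q)

reverseʷ : ∀ {n} {G : Graph n} {x y} → Walk G x y → Walk G y x
reverseʷ here               = here
reverseʷ {G = G} (step xw p) = reverseʷ p ++ʷ step (adj-sym G xw) here

rooted⇒connected : ∀ {n} {G : Graph n} {r} → (∀ x → Walk G x r) → Connected G
rooted⇒connected to-root x y = to-root x ++ʷ reverseʷ (to-root y)

pattern old x = suc (suc (suc x))

-- The new vertices are 0F, 1F, 2F; together with old 0F they span a K₄.
module _ {m} (G : Graph (suc m)) where

  attachedAdj : Fin (3 + suc m) → Fin (3 + suc m) → Bool
  attachedAdj (old x) (old y) = adj G x y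
  attachedAdj (old x) _       = ⁅ zero ⁆ x
  attachedAdj _       (old y) = ⁅ zero ⁆ y
  attachedAdj x       y       = not (⁅ x ⁆ y)

  attachedAdj-sym : ∀ x y → attachedAdj x y ≡ attachedAdj y x
  attachedAdj-sym 0F      0F      = refl
  attachedAdj-sym 0F      1F      = refl
  attachedAdj-sym 0F      2F      = refl
  attachedAdj-sym 0F      (old y) = refl
  attachedAdj-sym 1F      0F      = refl
  attachedAdj-sym 1F      1F      = refl
  attachedAdj-sym 1F      2F      = refl
  attachedAdj-sym 1F      (old y) = refl
  attachedAdj-sym 2F      0F      = refl
  attachedAdj-sym 2F      1F      = refl
  attachedAdj-sym 2F      2F      = refl
  attachedAdj-sym 2F      (old y) = refl
  attachedAdj-sym (old x) 0F      = refl
  attachedAdj-sym (old x) 1F      = refl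
  attachedAdj-sym (old x) 2F      = refl
  attachedAdj-sym (old x) (old y) = Graph.sym G x y

  attachedAdj-irrefl : ∀ x → attachedAdj x x ≡ false
  attachedAdj-irrefl 0F      = refl
  attachedAdj-irrefl 1F      = refl
  attachedAdj-irrefl 2F      = refl
  attachedAdj-irrefl (old x) = irrefl G x

  attachK4 : Graph (3 + suc m)
  attachK4 = record { adj = attachedAdj ; sym = attachedAdj-sym ; irrefl = attachedAdj-irrefl }

  attachK4-cover32 : Cover32 G → Cover32 attachK4
  attachK4-cover32 cover 0F      1F      _ = 2F , old 0F , (λ ()) , refl , refl , refl , refl
  attachK4-cover32 cover 0F      2F      _ = 1F , old 0F , (λ ()) , refl , refl , refl , refl
  attachK4-cover32 cover 0F      (old 0F) _ = 1F , 2F , (λ ()) , refl , refl , refl , refl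
  attachK4-cover32 cover 1F      0F      _ = 2F , old 0F , (λ ()) , refl , refl , refl , refl
  attachK4-cover32 cover 1F      2F      _ = 0F , old 0F , (λ ()) , refl , refl , refl , refl
  attachK4-cover32 cover 1F      (old 0F) _ = 0F , 2F , (λ ()) , refl , refl , refl , refl
  attachK4-cover32 cover 2F      0F      _ = 1F , old 0F , (λ ()) , refl , refl , refl , refl
  attachK4-cover32 cover 2F      1F      _ = 0F , old 0F , (λ ()) , refl , refl , refl , refl
  attachK4-cover32 cover 2F      (old 0F) _ = 0F , 1F , (λ ()) , refl , refl , refl , refl
  attachK4-cover32 cover (old 0F) 0F     _ = 1F , 2F , (λ ()) , refl , refl , refl , refl
  attachK4-cover32 cover (old 0F) 1F     _ = 0F , 2F , (λ ()) , refl , refl , refl , refl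
  attachK4-cover32 cover (old 0F) 2F     _ = 0F , 1F , (λ ()) , refl , refl , refl , refl
  attachK4-cover32 cover (old x) (old y) xy with cover x y xy
  ... | w , w' , w≢w' , xw , yw , xw' , yw' = old w , old w' , (λ { refl → w≢w' refl }) , xw , yw , xw' , yw'

  attachK4-rooted : (∀ x → Walk G x zero) → ∀ x → Walk attachK4 x 0F
  attachK4-rooted to-root 0F      = here
  attachK4-rooted to-root 1F      = step refl here
  attachK4-rooted to-root 2F      = step refl here
  attachK4-rooted to-root (old x) = lift (to-root x) ++ʷ step refl here
    where
      lift : ∀ {x y} → Walk G x y → Walk attachK4 (old x) (old y)
      lift here        = here
      lift (step xw p) = step xw (lift p)

  attachK4-degreeSum : degreeSum attachK4 ≡ 12 + degreeSum G
  attachK4-degreeSum = begin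
    degreeSum attachK4
      ≡⟨⟩
    (2 + ∣ ⁅ hub ⁆ ∣) + ((2 + ∣ ⁅ hub ⁆ ∣) + ((2 + ∣ ⁅ hub ⁆ ∣) + sum (λ x → deg attachK4 (old x))))
      ≡⟨ cong₂ (λ a b → a + (a + (a + b))) (cong (2 +_) (∣⁅⁆∣ hub)) old-vertices ⟩
    3 + (3 + (3 + (3 + degreeSum G)))
      ∎
    where
      open ≡-Reasoning
      hub : Fin (suc m)
      hub = zero
      ⟦⁅hub⁆⟧ : Fin (suc m) → ℕ
      ⟦⁅hub⁆⟧ x = ⟦ ⁅ hub ⁆ x ⟧
      old-vertices : sum (λ x → deg attachK4 (old x)) ≡ 3 + degreeSum G
      old-vertices = begin
        sum (λ x → ⟦ ⁅ hub ⁆ x ⟧ + (⟦ ⁅ hub ⁆ x ⟧ + (⟦ ⁅ hub ⁆ x ⟧ + deg G x)))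
          ≡⟨ ∑-distrib-+ ⟦⁅hub⁆⟧ (λ x → ⟦ ⁅ hub ⁆ x ⟧ + (⟦ ⁅ hub ⁆ x ⟧ + deg G x)) ⟩
        ∣ ⁅ hub ⁆ ∣ + sum (λ x → ⟦ ⁅ hub ⁆ x ⟧ + (⟦ ⁅ hub ⁆ x ⟧ + deg G x))
          ≡⟨ cong (∣ ⁅ hub ⁆ ∣ +_) (∑-distrib-+ ⟦⁅hub⁆⟧ (λ x → ⟦ ⁅ hub ⁆ x ⟧ + deg G x)) ⟩
        ∣ ⁅ hub ⁆ ∣ + (∣ ⁅ hub ⁆ ∣ + sum (λ x → ⟦ ⁅ hub ⁆ x ⟧ + deg G x))
          ≡⟨ cong (λ s → ∣ ⁅ hub ⁆ ∣ + (∣ ⁅ hub ⁆ ∣ + s)) (∑-distrib-+ ⟦⁅hub⁆⟧ (deg G)) ⟩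
        ∣ ⁅ hub ⁆ ∣ + (∣ ⁅ hub ⁆ ∣ + (∣ ⁅ hub ⁆ ∣ + degreeSum G))
          ≡⟨ cong (λ k → k + (k + (k + degreeSum G))) (∣⁅⁆∣ hub) ⟩
        3 + degreeSum G
          ∎

twoK4s : ∀ {n} → VertexSet n → VertexSet n → Fin n → Fin n → Bool
twoK4s A B x y = not (⁅ x ⁆ y) ∧ ((A x ∧ A y) ∨ (B x ∧ B y))

decidedGraph : ∀ {n} (a : Fin n → Fin n → Bool) →
  True (all? λ x → all? λ y → a x y ≟ᵇ a y x) → True (all? λ x → a x x ≟ᵇ false) → Graph n
decidedGraph a sym? irrefl? = record { adj = a ; sym = toWitness sym? ; irrefl = toWitness irrefl? }

K4 : Graph 4
K4 = decidedGraph (twoK4s (λ _ → true) (λ _ → true)) _ _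

K5-minus-edge : Graph 5
K5-minus-edge = decidedGraph (twoK4s (∁ ⁅ 4F ⁆) (∁ ⁅ 3F ⁆)) _ _

K6-minus-C4 : Graph 6
K6-minus-C4 = decidedGraph (twoK4s (∁ ⁅ 4F ⁆ ∩ ∁ ⁅ 5F ⁆) (∁ ⁅ 2F ⁆ ∩ ∁ ⁅ 3F ⁆)) _ _

DominatedSparseCover32 : ∀ {n} → Graph (suc n) → Set
DominatedSparseCover32 {n} G = Cover32 G × (∀ x → x ≡ zero ⊎ Adj G x zero) × degreeSum G + 2 ≤ 4 * suc n

dominatedSparseCover32? : ∀ {n} (G : Graph (suc n)) → Dec (DominatedSparseCover32 G)
dominatedSparseCover32? {n} G = cover32? ×-dec star? ×-dec (degreeSum G + 2 ≤? 4 * suc n)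
  where
    cover32? = all? λ u → all? λ v → (adj G u v ≟ᵇ true) →-dec
      any? λ w → any? λ w' → ¬? (w ≟ w') ×-dec (adj G u w ≟ᵇ true) ×-dec (adj G v w ≟ᵇ true)
        ×-dec (adj G u w' ≟ᵇ true) ×-dec (adj G v w' ≟ᵇ true)
    star? = all? λ x → (x ≟ zero) ⊎-dec (adj G x zero ≟ᵇ true)

sparse : ∀ m → Graph (4 + m)
sparse 0                   = K4
sparse 1                   = K5-minus-edge
sparse 2                   = K6-minus-C4
sparse (suc (suc (suc m))) = attachK4 (sparse m)

RootedSparseCover32 : ∀ {n} → Graph (suc n) → Set
RootedSparseCover32 {n} G = Cover32 G × (∀ x → Walk G x zero) × degreeSum G + 2 ≤ 4 * suc n

by-evaluation : ∀ {n} (G : Graph (suc n)) → True (dominatedSparseCover32? G) → RootedSparseCover32 G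
by-evaluation G ok with toWitness ok
... | cover , star , bound = cover , star⇒rooted , bound
  where
    star⇒rooted : ∀ x → Walk G x zero
    star⇒rooted x with star x
    ... | inj₁ refl = here
    ... | inj₂ x0   = step x0 here

sparse-rootedSparseCover32 : ∀ m → RootedSparseCover32 (sparse m)
sparse-rootedSparseCover32 0 = by-evaluation K4 _
sparse-rootedSparseCover32 1 = by-evaluation K5-minus-edge _
sparse-rootedSparseCover32 2 = by-evaluation K6-minus-C4 _
sparse-rootedSparseCover32 (suc (suc (suc m))) with sparse-rootedSparseCover32 m
... | cover , rooted , bound =
  attachK4-cover32 (sparse m) cover , attachK4-rooted (sparse m) rooted , (begin
    degreeSum (attachK4 (sparse m)) + 2     ≡⟨ cong (_+ 2) (attachK4-degreeSum (sparse m)) ⟩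
    12 + degreeSum (sparse m) + 2           ≡⟨ +-assoc 12 (degreeSum (sparse m)) 2 ⟩
    12 + (degreeSum (sparse m) + 2)         ≤⟨ +-monoʳ-≤ 12 bound ⟩
    12 + 4 * (4 + m)                        ≡⟨ *-distribˡ-+ 4 3 (4 + m) ⟨
    4 * (7 + m)                             ∎)
  where open ≤-Reasoning

minimal⇒sparse : ∀ m (G : Graph (4 + m)) →
  (∀ (H : Graph (4 + m)) → Connected H → Cover32 H → numEdges G ≤ numEdges H) → degreeSum G + 2 ≤ 4 * (4 + m)
minimal⇒sparse m G minimal with sparse-rootedSparseCover32 m
... | cover , rooted , bound = begin
  degreeSum G + 2              ≡⟨ cong (_+ 2) (handshake G) ⟩
  2 * numEdges G + 2           ≤⟨ +-monoˡ-≤ 2 (*-monoʳ-≤ 2 (minimal (sparse m) (rooted⇒connected rooted) cover)) ⟩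
  2 * numEdges (sparse m) + 2  ≡⟨ cong (_+ 2) (handshake (sparse m)) ⟨
  degreeSum (sparse m) + 2     ≤⟨ bound ⟩
  4 * (4 + m)                  ∎
  where open ≤-Reasoning

theorem3p4 : (n : ℕ) → 4 ≤ n → (G : Graph n) → Connected G → Cover32 G →
    (∀ (H : Graph n) → Connected H → Cover32 H → numEdges G ≤ numEdges H) →
    Cover41 G × IsF n (numEdges G)
theorem3p4 _ (s≤s (s≤s (s≤s (s≤s {n = m} _)))) G connected cover minimal =
  cover41 , (G , connected , cover41 , refl) ,
  λ H connected-H cover41-H → minimal H connected-H (Cover41⇒Cover32 {H = H} cover41-H)
  where
    cover41 : Cover41 G
    cover41 u v uv = decidable-stable (K4Through? G u v) λ noK4 →
      1+n≰n (+-cancelˡ-≤ (degreeSum G) 2 1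
        (≤-trans (minimal⇒sparse m G minimal) (NoK4Edge.dense connected cover uv noK4)))
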